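{- Let $D_S=(N_S,A_S\cup H_S)$ be a partially time-expanded network satisfying (P1)–(P4), let $\bar x$ be a feasible solution of $\mathrm{UPR}(D_T)$ and $\hat x=\mu(\bar x)$. Let $v\in N$, $(v,t)\in N_S$ with $t<T$, $e=((v,t),(v,\mathtt{n_S}(v,t)))\in H_S$ and $f=((v,t),(v,t+1))\in H_T$. Then $$\sum_{k\in\mathcal{K}^1_{\hat x}(v)}\hat x^k_e\le b_v.$$ If in addition $\mathtt{n_S}(v,t)=t+1$, then $$\sum_{k\in\mathcal{K}^1_{\hat x}(v)}\hat x^k_e\le\sum_{k\in\mathcal{K}^1_{\hat x}(v)}\bar x^k_f.$$
   Context: Base network: a directed graph $D=(N,A)$; each arc $vw\in A$ has a transit time $\tau_{vw}\in\mathbb{N}$ and a capacity $u_{vw}\in\mathbb{N}$; each node $v\in N$ has a storage capacity $b_v\in\mathbb{N}$. $\mathcal{K}$ is a finite set of packets; packet $k$ has origin $s_k$ and destination $t_k$. For $v\in N$ let $\mathcal{K}_v=\{k\in\mathcal{K}: s_k\ne v,\ t_k\ne v\}$. Fix $T\in\mathbb{N}$, $[T]=\{0,\dots,T\}$. Fully time-expanded network $D_T=(N_T,A_T\cup H_T)$: $N_T=\{(v,t):v\in N,t\in[T]\}$; movement arcs $A_T=\{((v,t),(w,t+\tau_{vw})): (v,t)\in N_T, vw\in A, t+\tau_{vw}\le T\}$; holdover arcs $H_T=\{((v,t),(v,t+1)): v\in N, 0\le t<T\}$. $\mathrm{UPR}(D_T)$ is the integer program with binary variables $x^k_e$ ($k\in\mathcal{K}$,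 $e\in A_T\cup H_T$) and variable $\bar T$: minimize $\bar T$ s.t. $t'x^k_e\le\bar T$ for all $k$, $e=((v,t),(w,t'))\in A_T$; $\sum_{e=((v,t),(w,t'))\in A_T,\,w=t_k}t'x^k_e\le\bar T$ for all $k$; flow conservation for each $k$ at each $(v,t)\in N_T$ (out minus in equals $1$ at $(s_k,0)$, $-1$ at $(t_k,T)$, $0$ otherwise); $\sum_k x^k_e\le u_{vw}$ for each copy $e\in A_T$ of $vw$; $\sum_{k\in\mathcal{K}_v}x^k_e\le b_v$ for each holdover arc $e$ at $v$. A feasible solution gives each packet $k$ a trajectory $Q_k$ (directed path) in $D_T$ from $(s_k,0)$ to $(t_k,T)$. Partially time-expanded network: $N_S\subseteq N_T$; $\mathtt{n_S}(v,t)=\min\{t'>t:(v,t')\in N_S\}$, $\mathtt{m_S}(v,t)=\mathtt{n_S}(v,t)-t$; $H_S$ consists of the arcs $((v,t),(v,\mathtt{n_S}(v,t)))$ for $(v,t)\in N_S$, $t<T$; $A_S$ is a set of arcs $((v,t),(w,t'))$ with both ends in $N_S$ and $vw\in A$. Properties: (P1) $(s_k,0),(t_k,T)\in N_S$ for all $k$; (P2) each $((v,t),(w,t'))\in A_S$ has $t'\le t+\tau_{vw}$; (P3) for each $vw\in A$ and $(v,t)\in N_S$ with $t+\tau_{vw}\le T$, $A_S$ contains a copy of $vw$ starting at $(v,t)$; (P4) if $((v,t),(w,t'))\in A_S$ there is no $(w,t'')\in N_S$ with $t'<t''\le t+\tau_{vw}$. Map $\mu:A_T\to A_S$: $((v,\bar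 t),(w,\bar t'))\mapsto((v,\hat t),(w,\hat t'))$, $\hat t=\max\{t\le\bar t:(v,t)\in N_S\}$, $\hat t'=\max\{t\le\hat t+\tau_{vw}:(w,t)\in N_S\}$. For feasible $\bar x$, $\hat x=\mu(\bar x)$: for each $k$, $\hat x^k$ is the incidence vector of the trajectory in $D_S$ whose movement arcs are the $\mu$-images of the movement arcs of $Q_k$ in order, joined by holdover arcs of $H_S$. For a packet $k$ whose path visits $v$ immediately after node $u$, its movement arc from $u$ to $v$ in $\bar x$ departs $u$ at time $\bar t^{k,out}_u$, and its $\mu$-image departs $u$ at time $\hat t^{k,out}_u\le\bar t^{k,out}_u$. $\mathcal{K}(v)$ is the set of packets in $\mathcal{K}_v$ whose trajectory in $\bar x$ contains a timed copy of $v$; $\mathcal{K}^1_{\hat x}(v)=\{k\in\mathcal{K}(v):\hat t^{k,out}_u=\bar t^{k,out}_u\}$ and $\mathcal{K}^2_{\hat x}(v)=\{k\in\mathcal{K}(v):\hat t^{k,out}_u<\bar t^{k,out}_u\}$. -}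

module Defs where

open import Data.Nat using (ℕ; zero; suc; _+_; _*_; _∸_; _≤_; _<_; _≤ᵇ_; _<ᵇ_; _≡ᵇ_)
open import Data.Bool using (Bool; true; false; _∧_; _∨_; not; if_then_else_)
open import Data.Fin using (Fin; zero; suc)
import Data.Fin as F
open import Data.List using (List; []; _∷_; map)
open import Data.Bool.ListAction using (any; all)
open import Data.List.Relation.Unary.All using (All)
open import Data.Product using (Σ; ∃; _×_; _,_)
open import Relation.Binary.PropositionalEquality using (_≡_)
open import Relation.Nullary.Decidable using (⌊_⌋)

∑ : ∀ {n} → (Fin n → ℕ) → ℕ
∑ {zero}  f = 0
∑ {suc n} f = f zero + ∑ (λ i → f (suc i))

∑< : ℕ → (ℕ → ℕ) → ℕ
∑< zero    f = 0
∑< (suc n) f = ∑< n f + f n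

[_] : Bool → ℕ
[ true ]  = 1
[ false ] = 0

_==_ : ∀ {n} → Fin n → Fin n → Bool
i == j = ⌊ i F.≟ j ⌋

-- Instance: base network D = (N, A) and packet set 𝒦
-- nodes = Fin nN, arcs = Fin nA (arc a goes from tl a to hd a),
-- packets = Fin nK (packet k goes from src k to dst k)

record Instance : Set where
  field
    nN nA nK : ℕ
    tl hd    : Fin nA → Fin nN
    τ        : Fin nA → ℕ      -- transit time
    cap      : Fin nA → ℕ
    b        : Fin nN → ℕ      -- storage capacity
    src dst  : Fin nK → Fin nN

module _ (I : Instance) where
  open Instance I

  inKv : Fin nN → Fin nK → Bool
  inKv v k = not (src k == v) ∧ not (dst k == v)

  -- Variables of UPR(D_T):
  --   xm k a d = x^k_e for the movement arc e = ((tl a, d), (hd a, d + τ a))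
  --   xh k v t = x^k_e for the holdover arc e = ((v, t), (v, t + 1))
  -- (only entries with d + τ a ≤ T, resp. t < T, are variables)

  record Vars : Set where
    field
      xm : Fin nK → Fin nA → ℕ → ℕ
      xh : Fin nK → Fin nN → ℕ → ℕ

  module _ (T : ℕ) (x : Vars) where
    open Vars x

    outflow : Fin nK → Fin nN → ℕ → ℕ
    outflow k v t =
      ∑ (λ a → [ (tl a == v) ∧ (t + τ a ≤ᵇ T) ] * xm k a t) + [ t <ᵇ T ] * xh k v t

    inflow : Fin nK → Fin nN → ℕ → ℕ
    inflow k v t =
      ∑ (λ a → [ (hd a == v) ∧ (τ a ≤ᵇ t) ] * xm k a (t ∸ τ a)) + [ 0 <ᵇ t ] * xh k v (t ∸ 1)

    -- feasibility for UPR(D_T) (there is some value of the variable T̄)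
    record Feasible : Set where
      field
        binary-m : ∀ k a d → d + τ a ≤ T → xm k a d ≤ 1
        binary-h : ∀ k v t → t < T → xh k v t ≤ 1
        makespan : Σ ℕ λ T̄ →
          (∀ k a d → d + τ a ≤ T → (d + τ a) * xm k a d ≤ T̄) ×
          (∀ k → ∑ (λ a → [ hd a == dst k ] *
                   ∑< (suc T) (λ d → [ d + τ a ≤ᵇ T ] * ((d + τ a) * xm k a d))) ≤ T̄)
        -- out − in = 1 at (s_k,0), −1 at (t_k,T), 0 otherwise (written over ℕ)
        conservation : ∀ k v t → t ≤ T →
          outflow k v t + [ (v == dst k) ∧ (t ≡ᵇ T) ] ≡ inflow k v t + [ (v == src k) ∧ (t ≡ᵇ 0) ]
        capacity : ∀ a d → d + τ a ≤ T → ∑ (λ k → xm k a d) ≤ cap a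
        storage  : ∀ v t → t < T → ∑ (λ k → [ inKv v k ] * xh k v t) ≤ b v

  -- Partially time-expanded network D_S with properties (P1)–(P4).
  -- inS v t = true  iff (v,t) ∈ N_S ;  AS a t t'  iff ((tl a,t),(hd a,t')) ∈ A_S

  record PartialNet (T : ℕ) : Set₁ where
    field
      inS    : Fin nN → ℕ → Bool
      AS     : Fin nA → ℕ → ℕ → Set
      NS⊆NT  : ∀ v t → inS v t ≡ true → t ≤ T
      AS-ends : ∀ a t t' → AS a t t' → (inS (tl a) t ≡ true) × (inS (hd a) t' ≡ true)
      P1     : ∀ k → (inS (src k) 0 ≡ true) × (inS (dst k) T ≡ true)
      P2     : ∀ a t t' → AS a t t' → t' ≤ t + τ a
      P3     : ∀ a t → inS (tl a) t ≡ true → t + τ a ≤ T → ∃ λ t' → AS a t t'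
      P4     : ∀ a t t' → AS a t t' → ∀ t'' → t' < t'' → t'' ≤ t + τ a → inS (hd a) t'' ≡ false

  IsNext : (Fin nN → ℕ → Bool) → Fin nN → ℕ → ℕ → Set
  IsNext inS v t t' =
    (t < t') × (inS v t' ≡ true) × (∀ t'' → t < t'' → t'' < t' → inS v t'' ≡ false)

  -- max { t ≤ n : p t } (used only where this set is nonempty; 0 otherwise)
  maxBelow : (ℕ → Bool) → ℕ → ℕ
  maxBelow p zero    = 0
  maxBelow p (suc n) = if p (suc n) then suc n else maxBelow p n

  -- Trajectories in D_T, given by their movement arcs in order:
  -- a list of (arc a, departure time d); holdover arcs fill the gaps.

  Traj : Set
  Traj = List (Fin nA × ℕ)

  WalkFrom : ℕ → Fin nN → Fin nN → ℕ → Traj → Set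
  WalkFrom T goal v r []             = v ≡ goal
  WalkFrom T goal v r ((a , d) ∷ q) =
    (tl a ≡ v) × (r ≤ d) × (d + τ a ≤ T) × WalkFrom T goal (hd a) (d + τ a) q

  -- movement arcs with (departure, arrival) times
  TimedArcs : Set
  TimedArcs = List (Fin nA × ℕ × ℕ)

  -- waiting intervals (node, arrival, departure): the holdover parts of
  -- a trajectory starting at (v, r) and ending at time T
  waits : ℕ → Fin nN → ℕ → TimedArcs → List (Fin nN × ℕ × ℕ)
  waits T v r []                   = (v , r , T) ∷ []
  waits T v r ((a , d , r') ∷ q) = (v , r , d) ∷ waits T (hd a) r' q

  barArcs : Traj → TimedArcs
  barArcs = map (λ { (a , d) → (a , d , d + τ a) })

  -- μ-images of the movement arcs:
  -- ((v,d),(w,d+τ)) ↦ ((v,d̂),(w,d̂')), d̂ = max{t ≤ d : (v,t)∈N_S},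
  -- d̂' = max{t ≤ d̂ + τ : (w,t) ∈ N_S}
  hatDep : (Fin nN → ℕ → Bool) → Fin nA → ℕ → ℕ
  hatDep inS a d = maxBelow (inS (tl a)) d

  hatArcs : (Fin nN → ℕ → Bool) → Traj → TimedArcs
  hatArcs inS = map (λ { (a , d) →
    (a , hatDep inS a d , maxBelow (inS (hd a)) (hatDep inS a d + τ a)) })

  module _ (T : ℕ) (S : PartialNet T) (Q : Fin nK → Traj) where
    open PartialNet S

    -- x̂^k_e for the holdover arc e = ((v,t),(v,t')) of H_S
    -- (the μ-trajectory waits at v from r to d, with r ≤ t and t' ≤ d)
    xhat-h : Fin nK → Fin nN → ℕ → ℕ → ℕ
    xhat-h k v t t' =
      [ any (λ { (w , r , d) → (w == v) ∧ (r ≤ᵇ t) ∧ (t' ≤ᵇ d) })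
            (waits T (src k) 0 (hatArcs inS (Q k))) ]

    inK : Fin nN → Fin nK → Bool
    inK v k = inKv v k ∧
      any (λ { (w , r , d) → w == v }) (waits T (src k) 0 (barArcs (Q k)))

    inK1 : Fin nN → Fin nK → Bool
    inK1 v k = inK v k ∧
      all (λ { (a , d) → not (hd a == v) ∨ (hatDep inS a d ≡ᵇ d) }) (Q k)

  record Trajectories (T : ℕ) (x : Vars) (Q : Fin nK → Traj) : Set where
    open Vars x
    field
      walk : ∀ k → WalkFrom T (dst k) (src k) 0 (Q k)
      supp-m : ∀ k → All (λ { (a , d) → xm k a d ≡ 1 }) (Q k)
      supp-h : ∀ k → All (λ { (w , r , d) → ∀ s → r ≤ s → s < d → xh k w s ≡ 1 })
                         (waits T (src k) 0 (barArcs (Q k)))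

{-# OPTIONS --safe #-}
-- A packet of 𝒦¹(v) reaches v along an arc whose departure time μ keeps, so the
-- μ-image arrives at v at r̂ = max{s ≤ r : (v,s) ∈ N_S}, where r is the true arrival
-- time, and leaves v no later than the true departure. If the image waits at v over
-- [t, t'] with t' ∈ N_S, then r̂ ≤ t < t' forces r < t', so Q_k waits at v during
-- [t' − 1, t']. Hence the image holdovers are dominated packetwise by the holdover
-- arc ((v, t' − 1), (v, t')) of D_T, whose storage constraint bounds them by b_v;
-- when t' = t + 1 that arc is f itself.
module Submission where

open import Defs
open import Data.Nat using (ℕ; suc; _+_; _*_; _≤_; _<_; pred; z≤n; s≤s; _≤ᵇ_)
open import Data.Nat.Properties
  using (≤-refl; ≤-trans; <-≤-trans; +-mono-≤; <⇒≤pred; <⇒≱; ≰⇒>; ≤ᵇ⇒≤; ≡ᵇ⇒≡;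
         m≤n⇒m≤1+n; m≤n⇒m<n∨m≡n; m<1+n⇒m≤n)
open import Data.Bool using (Bool; true; false; T; not; _∧_; _∨_)
open import Data.Bool.Properties using (T-∧; T-≡)
open import Data.Empty using (⊥-elim)
open import Data.Fin using (Fin; zero; suc)
import Data.Fin as F
open import Data.List using ([]; _∷_)
open import Data.List.Relation.Unary.All using (All; []; _∷_)
import Data.List.Relation.Unary.All as All
open import Data.List.Relation.Unary.All.Properties using (all⁺)
open import Data.List.Relation.Unary.Any using (Any; here; there)
import Data.List.Relation.Unary.Any as Any
open import Data.List.Relation.Unary.Any.Properties using (any⁻)
open import Data.List.Relation.Binary.Pointwise using (Pointwise; []; _∷_)
open import Data.Product using (_×_; _,_; proj₁; proj₂)
open import Data.Sum using (inj₁; inj₂)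
open import Function.Bundles using (Equivalence)
open import Relation.Binary.PropositionalEquality using (_≡_; refl; cong; subst)
open import Relation.Nullary.Decidable using (toWitness; fromWitness)

∑-mono-≤ : ∀ {n} {f g : Fin n → ℕ} → (∀ i → f i ≤ g i) → ∑ f ≤ ∑ g
∑-mono-≤ {ℕ.zero}  f≤g = z≤n
∑-mono-≤ {suc n} f≤g = +-mono-≤ (f≤g zero) (∑-mono-≤ (λ i → f≤g (suc i)))

[b]≤1 : ∀ b → [ b ] ≤ 1
[b]≤1 true  = ≤-refl
[b]≤1 false = z≤n

[b]≡1⇒T : ∀ {b} → [ b ] ≡ 1 → T b
[b]≡1⇒T {true} _ = _

[b]*m≤[c]*n : ∀ b c {m n} → m ≤ 1 → (T b → m ≡ 1 → T c × n ≡ 1) → [ b ] * m ≤ [ c ] * n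
[b]*m≤[c]*n false c                  m≤1 _ = z≤n
[b]*m≤[c]*n true  c     {ℕ.zero}      m≤1 _ = z≤n
[b]*m≤[c]*n true  false {suc ℕ.zero} m≤1 h = ⊥-elim (proj₁ (h _ refl))
[b]*m≤[c]*n true  true  {suc ℕ.zero} m≤1 h rewrite proj₂ (h _ refl) = ≤-refl
[b]*m≤[c]*n true  c     {suc (suc _)} (s≤s ()) _

<⇒pred[n]<n : ∀ {m n} → m < n → pred n < n
<⇒pred[n]<n (s≤s _) = ≤-refl

T-not-∨ : ∀ {b c} → T (not b ∨ c) → T b → T c
T-not-∨ {true} c _ = c

module _ (I : Instance) where
  open Instance I

  maxBelow-≤ : ∀ p n → maxBelow I p n ≤ n
  maxBelow-≤ p ℕ.zero = z≤n
  maxBelow-≤ p (suc n) with p (suc n)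
  ... | true  = ≤-refl
  ... | false = m≤n⇒m≤1+n (maxBelow-≤ p n)

  maxBelow-maximal : ∀ p {m} n → T (p m) → m ≤ n → m ≤ maxBelow I p n
  maxBelow-maximal p ℕ.zero pm m≤n = m≤n
  maxBelow-maximal p (suc n) pm m≤n with p (suc n) in eq | m≤n⇒m<n∨m≡n m≤n
  ... | true  | _          = m≤n
  ... | false | inj₁ m<1+n = maxBelow-maximal p n pm (m<1+n⇒m≤n m<1+n)
  ... | false | inj₂ refl  = ⊥-elim (subst T eq pm)

  Wait : Set
  Wait = Fin nN × ℕ × ℕ

  Occupied : (Fin nN → ℕ → ℕ) → Wait → Set
  Occupied X (w , r , d) = ∀ s → r ≤ s → s < d → X w s ≡ 1

  module _ (inS : Fin nN → ℕ → Bool) (v : Fin nN) where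

    KeepsDepartureInto : Fin nA × ℕ → Set
    KeepsDepartureInto (a , d) = hd a ≡ v → hatDep I inS a d ≡ d

    -- Arrival times are related only at v: μ may move the departure of arcs into other nodes.
    ImageWait : Wait → Wait → Set
    ImageWait (ŵ , r̂ , d̂) (w , r , d) = ŵ ≡ w × d̂ ≤ d × (w ≡ v → r̂ ≡ maxBelow I (inS v) r)

    waits-image : ∀ horizon q {u r̂ r} → All KeepsDepartureInto q →
      (u ≡ v → r̂ ≡ maxBelow I (inS v) r) →
      Pointwise ImageWait (waits I horizon u r̂ (hatArcs I inS q)) (waits I horizon u r (barArcs I q))
    waits-image horizon []            _                arrival = (refl , ≤-refl , arrival) ∷ []
    waits-image horizon ((a , d) ∷ q) (keeps ∷ keepss) arrival =
      (refl , maxBelow-≤ (inS (tl a)) d , arrival) ∷ waits-image horizon q keepss arrival′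
      where
      arrival′ : hd a ≡ v →
        maxBelow I (inS (hd a)) (hatDep I inS a d + τ a) ≡ maxBelow I (inS v) (d + τ a)
      arrival′ refl = cong (λ d̂ → maxBelow I (inS v) (d̂ + τ a)) (keeps refl)

    Covers : ℕ → ℕ → Wait → Set
    Covers t t' (w , r , d) = w ≡ v × r ≤ t × t' ≤ d

    module _ {t t' : ℕ} (t<t' : t < t') (t'∈S : T (inS v t')) where

      image-covers⇒occupied : ∀ {X ŵ w} → ImageWait ŵ w → Covers t t' ŵ → Occupied X w →
                              X v (pred t') ≡ 1
      image-covers⇒occupied {w = _ , r , d} (refl , d̂≤d , r̂≡) (refl , r̂≤t , t'≤d̂) occupied =
        occupied (pred t') (<⇒≤pred r<t') (<-≤-trans (<⇒pred[n]<n t<t') (≤-trans t'≤d̂ d̂≤d))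
        where
        r<t' : r < t'
        r<t' = ≰⇒> λ t'≤r → <⇒≱ t<t'
          (≤-trans (maxBelow-maximal (inS v) r t'∈S t'≤r) (subst (_≤ t) (r̂≡ refl) r̂≤t))

      covered-image⇒occupied : ∀ {X ŵs ws} → Pointwise ImageWait ŵs ws → Any (Covers t t') ŵs →
                               All (Occupied X) ws → X v (pred t') ≡ 1
      covered-image⇒occupied {X} (i ∷ _)  (here c)  (o ∷ _)  = image-covers⇒occupied {X} i c o
      covered-image⇒occupied {X} (_ ∷ is) (there c) (_ ∷ os) = covered-image⇒occupied {X} is c os

  module _ {horizon : ℕ} (S : PartialNet I horizon) {Q : Fin nK → Traj I} (v : Fin nN) where
    open PartialNet S

    inK1⇒inKv : ∀ {k} → T (inK1 I horizon S Q v k) → T (inKv I v k)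
    inK1⇒inKv k∈𝒦¹ = proj₁ (Equivalence.to T-∧ (proj₁ (Equivalence.to T-∧ k∈𝒦¹)))

    image-holdover⇒holdover : ∀ {x : Vars I} → Trajectories I horizon x Q →
      ∀ {t t'} → t < t' → inS v t' ≡ true →
      ∀ k → T (inK1 I horizon S Q v k) → xhat-h I horizon S Q k v t t' ≡ 1 →
      Vars.xh x k v (pred t') ≡ 1
    image-holdover⇒holdover {x} traj {t} {t'} t<t' t'∈S k k∈𝒦¹ x̂≡1 =
      covered-image⇒occupied inS v t<t' (Equivalence.from T-≡ t'∈S) {Vars.xh x k}
        (waits-image inS v horizon (Q k) keeps (λ _ → refl))
        (Any.map covers (any⁻ _ _ ([b]≡1⇒T x̂≡1)))
        (Trajectories.supp-h traj k)
      where
      keeps : All (KeepsDepartureInto inS v) (Q k)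
      keeps = All.map (λ keep hd≡v → ≡ᵇ⇒≡ _ _ (T-not-∨ keep (fromWitness hd≡v)))
                      (all⁺ _ _ (proj₂ (Equivalence.to T-∧ k∈𝒦¹)))

      covers : ∀ {w r d} → T ((w == v) ∧ (r ≤ᵇ t) ∧ (t' ≤ᵇ d)) → Covers inS v t t' (w , r , d)
      covers {w} c with Equivalence.to T-∧ c
      ... | w≡v , c′ with Equivalence.to T-∧ c′
      ...   | r≤t , t'≤d = toWitness {a? = w F.≟ v} w≡v , ≤ᵇ⇒≤ _ _ r≤t , ≤ᵇ⇒≤ _ _ t'≤d

lemma5 : (I : Instance) (T : ℕ) (S : PartialNet I T) (x : Vars I) →
    Feasible I T x →
    (Q : Fin (Instance.nK I) → Traj I) → Trajectories I T x Q →
    (v : Fin (Instance.nN I)) (t t' : ℕ) →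
    PartialNet.inS S v t ≡ true → t < T → IsNext I (PartialNet.inS S) v t t' →
    (∑ (λ k → [ inK1 I T S Q v k ] * xhat-h I T S Q k v t t') ≤ Instance.b I v) ×
    (t' ≡ suc t →
      ∑ (λ k → [ inK1 I T S Q v k ] * xhat-h I T S Q k v t t')
        ≤ ∑ (λ k → [ inK1 I T S Q v k ] * Vars.xh x k v t))
lemma5 I horizon S x feasible Q traj v t t' _ _ (t<t' , t'∈S , _) =
  ≤-trans (∑-mono-≤ λ k → [b]*m≤[c]*n _ _ ([b]≤1 _) λ k∈𝒦¹ x̂≡1 →
             inK1⇒inKv I S {Q} v k∈𝒦¹ , holdover k k∈𝒦¹ x̂≡1)
          (Feasible.storage feasible v (pred t')
             (<-≤-trans (<⇒pred[n]<n t<t') (PartialNet.NS⊆NT S v t' t'∈S)))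
  , λ { refl → ∑-mono-≤ λ k → [b]*m≤[c]*n _ _ ([b]≤1 _) λ k∈𝒦¹ x̂≡1 →
                 k∈𝒦¹ , holdover k k∈𝒦¹ x̂≡1 }
  where
  holdover : ∀ k → T (inK1 I horizon S Q v k) → xhat-h I horizon S Q k v t t' ≡ 1 →
             Vars.xh x k v (pred t') ≡ 1
  holdover = image-holdover⇒holdover I S v traj t<t' t'∈S
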